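{- Let $G$ be a finite simple graph of order $2n$ with a perfect matching. Then $$F(G)\leq\frac{\sqrt{e(G)^2+2(n+1)e(G)-3n^2-2n+1}}{2}-\frac{e(G)+1-n}{2}.$$
   Context: For a graph $G$ with a perfect matching $M$, a subset $S\subseteq M$ is a forcing set of $M$ if $S$ is contained in no perfect matching of $G$ other than $M$. $f(G,M)$ is the minimum size of a forcing set of $M$, and $F(G)=\max_M f(G,M)$ over all perfect matchings $M$ of $G$. $e(G)$ is the number of edges. -}

module Defs where

open import Data.Nat using (ℕ; zero; suc; _+_; _*_; _≤_; _<_)
open import Data.Nat.Base using (_<ᵇ_)
open import Data.Bool using (Bool; true; false; _∧_; if_then_else_)
open import Data.Fin using (Fin; zero; suc; toℕ)
open import Data.Product using (Σ; _×_; ∃)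
open import Relation.Binary.PropositionalEquality using (_≡_; _≢_)

sumFin : (n : ℕ) → (Fin n → ℕ) → ℕ
sumFin zero    f = 0
sumFin (suc n) f = f zero + sumFin n (λ i → f (suc i))

record Graph (v : ℕ) : Set where
  field
    adj   : Fin v → Fin v → Bool
    sym   : ∀ i j → adj i j ≡ adj j i
    loopless : ∀ i → adj i i ≡ false
open Graph public

edges : {v : ℕ} → Graph v → ℕ
edges {v} G = sumFin v (λ i → sumFin v (λ j →
  if adj G i j ∧ (toℕ i <ᵇ toℕ j) then 1 else 0))

-- A perfect matching of G, represented as the partner map m : each vertex i
-- is matched with m i, the edge {i, m i} is an edge of G, and m is a
-- fixed-point-free involution (so the edges {i, m i} are disjoint and cover V).
record PerfectMatching {v : ℕ} (G : Graph v) : Set where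
  field
    partner : Fin v → Fin v
    isEdge  : ∀ i → adj G i (partner i) ≡ true
    invol   : ∀ i → partner (partner i) ≡ i
    noFix   : ∀ i → partner i ≢ i
open PerfectMatching public

-- A subset S of the edges of M, represented by the set of covered vertices,
-- which must be closed under the partner map (so it is a union of M-edges).
record EdgeSubset {v : ℕ} {G : Graph v} (M : PerfectMatching G) : Set where
  field
    mem    : Fin v → Bool
    closed : ∀ i → mem i ≡ mem (partner M i)
open EdgeSubset public

size : {v : ℕ} {G : Graph v} {M : PerfectMatching G} → EdgeSubset M → ℕ
size {v} {M = M} S = sumFin v (λ i →
  if mem S i ∧ (toℕ i <ᵇ toℕ (partner M i)) then 1 else 0)

ContainedIn : {v : ℕ} {G : Graph v} {M : PerfectMatching G} →
              EdgeSubset M → PerfectMatching G → Set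
ContainedIn {M = M} S M' = ∀ i → mem S i ≡ true → partner M' i ≡ partner M i

Forcing : {v : ℕ} {G : Graph v} (M : PerfectMatching G) → EdgeSubset M → Set
Forcing {G = G} M S =
  (M' : PerfectMatching G) → ContainedIn S M' → ∀ i → partner M' i ≡ partner M i

IsForcingNumber : {v : ℕ} {G : Graph v} → PerfectMatching G → ℕ → Set
IsForcingNumber M k =
  (Σ (EdgeSubset M) λ S → Forcing M S × size S ≡ k) ×
  (∀ (S : EdgeSubset M) → Forcing M S → k ≤ size S)

IsMaxForcingNumber : {v : ℕ} → Graph v → ℕ → Set
IsMaxForcingNumber G k =
  (Σ (PerfectMatching G) λ M → IsForcingNumber M k) ×
  (∀ (M : PerfectMatching G) (k' : ℕ) → IsForcingNumber M k' → k' ≤ k)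

-- Fix a perfect matching M.  Starting from R = V, repeatedly pick u
-- of minimum degree d in G[R], leave u's M-edge out of the forcing set, and delete from R
-- the union X of the M-edges meeting N(u) ∩ R; all other M-edges form the forcing set.
-- The left-out edges are forced in the order they were chosen: a perfect matching M′ that
-- agrees with M elsewhere matches u to a neighbour, which lies outside R ∖ X and hence on
-- no later left-out edge, so M′ u = M u.  With P(R) = Σ_{w ∈ R} deg_R w, a step has
-- |X| ≤ 2d and P(R ∖ X) + |X| d ≤ P(R), which preserves |R|² ≤ |T| P(R) for T the set of
-- left-out vertices.  At R = V this is (2n)² ≤ 2t · 2e, so n² ≤ t e where s = n − t is
-- the size of the forcing set, s ≥ f(G, M); with e = n + E this yields
-- F (F + 1) + F E ≤ n E, which is the stated bound squared out.

module Submission where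

open import Defs hiding (sym)
open import Data.Nat using (ℕ)

module ForcingBound where

  import Data.Nat.Properties as ℕ
  open import Algebra.Properties.Semiring.Sum ℕ.+-*-semiring
    using (sum-syntax; sum-cong-≗; sum-replicate-zero; ∑-distrib-+; ∑-comm; ∑-permute; *-distribʳ-sum)
  open import Data.Bool.Base using (Bool; true; false; _∧_; _∨_; not; if_then_else_)
  open import Data.Bool.Properties using (∨-comm; ∨-zeroʳ; ¬-not) renaming (_≟_ to _≟ᴮ_)
  open import Data.Fin.Base using (Fin; zero; suc; toℕ)
  open import Data.Fin.Properties using (toℕ-injective; _≟_)
  import Data.Fin.Permutation as Perm
  import Data.Integer.Base as ℤ
  import Data.Integer.Properties as ℤ
  open import Data.List.Base using (List; []; _∷_; filter; allFin)
  open import Data.List.Extrema.Nat using (argmin; argmin-all; f[argmin]≤f[xs])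
  open import Data.List.Membership.Propositional using (_∈_)
  open import Data.List.Membership.Propositional.Properties using (∈-filter⁺; ∈-allFin)
  open import Data.List.Relation.Unary.All as All using (All)
  open import Data.List.Relation.Unary.All.Properties using (all-filter)
  open import Data.List.Relation.Unary.Any.Properties using (¬Any[])
  open import Data.Nat.Base
  open import Data.Nat.Induction using (<-wellFounded)
  open import Data.Nat.Properties hiding (_≟_)
  open import Data.Nat.Tactic.RingSolver using (solve-∀)
  open import Data.Product.Base using (Σ-syntax; _×_; _,_)
  open import Data.Sum.Base using (_⊎_; inj₁; inj₂; [_,_]′)
  open import Function.Base using (_∘_)
  import Induction.WellFounded as WF
  import Relation.Binary.Construct.On as On
  open import Relation.Binary.PropositionalEquality
  open import Relation.Nullary.Decidable using (does; yes; no; dec-false)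
  open import Relation.Nullary.Negation using (contradiction)
  open import Relation.Nullary.Reflects using (ofʸ; ofⁿ)

  𝟙 : Bool → ℕ
  𝟙 b = if b then 1 else 0

  𝟙-split : ∀ a b → (b ≡ true → a ≡ true) → 𝟙 a ≡ 𝟙 (a ∧ not b) + 𝟙 b
  𝟙-split false false _ = refl
  𝟙-split true  false _ = refl
  𝟙-split true  true  _ = refl
  𝟙-split false true  b⇒a with () ← b⇒a refl

  𝟙-*-mono : ∀ a {k l} → (a ≡ true → k ≤ l) → 𝟙 a * k ≤ 𝟙 a * l
  𝟙-*-mono false _   = z≤n
  𝟙-*-mono true  k≤l = +-monoˡ-≤ 0 (k≤l refl)

  𝟙-∨-≤ : ∀ a b → 𝟙 (a ∨ b) ≤ 𝟙 a + 𝟙 b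
  𝟙-∨-≤ false b     = ≤-refl
  𝟙-∨-≤ true  false = ≤-refl
  𝟙-∨-≤ true  true  = s≤s z≤n

  𝟙-∨-disjoint : ∀ a b → (a ≡ true → b ≡ false) → 𝟙 (a ∨ b) ≡ 𝟙 a + 𝟙 b
  𝟙-∨-disjoint false b     _ = refl
  𝟙-∨-disjoint true  false _ = refl
  𝟙-∨-disjoint true  true  h with () ← h refl

  𝟙-split-<ᵇ : ∀ b {i j} → (i ≡ j → b ≡ false) →
               𝟙 b ≡ 𝟙 (b ∧ (i <ᵇ j)) + 𝟙 (b ∧ (j <ᵇ i))
  𝟙-split-<ᵇ false     _ = refl
  𝟙-split-<ᵇ true {i} {j} h with i <ᵇ j | <ᵇ-reflects-< i j | j <ᵇ i | <ᵇ-reflects-< j i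
  ... | true  | _        | false | _        = refl
  ... | false | _        | true  | _        = refl
  ... | true  | ofʸ i<j  | true  | ofʸ j<i  = contradiction j<i (<⇒≯ i<j)
  ... | false | ofⁿ i≮j  | false | ofⁿ j≮i  with () ← h (≤-antisym (≮⇒≥ j≮i) (≮⇒≥ i≮j))

  sumFin≡∑ : ∀ n (f : Fin n → ℕ) → sumFin n f ≡ ∑[ i < n ] f i
  sumFin≡∑ zero    f = refl
  sumFin≡∑ (suc n) f = cong (f zero +_) (sumFin≡∑ n (f ∘ suc))

  ∑-mono-≤ : ∀ {n} {f g : Fin n → ℕ} → (∀ i → f i ≤ g i) → ∑[ i < n ] f i ≤ ∑[ i < n ] g i
  ∑-mono-≤ {zero}  f≤g = z≤n
  ∑-mono-≤ {suc n} f≤g = +-mono-≤ (f≤g zero) (∑-mono-≤ (f≤g ∘ suc))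

  ∑-const-1 : ∀ n → ∑[ i < n ] 1 ≡ n
  ∑-const-1 zero    = refl
  ∑-const-1 (suc n) = cong suc (∑-const-1 n)

  ∑-𝟙[w≟u]≡1 : ∀ {n} (u : Fin n) → ∑[ w < n ] 𝟙 (does (w ≟ u)) ≡ 1
  ∑-𝟙[w≟u]≡1 {suc n} zero    = cong suc (sum-replicate-zero n)
  ∑-𝟙[w≟u]≡1 {suc n} (suc u) = trans (sum-cong-≗ (cong 𝟙 ∘ suc-≟-suc)) (∑-𝟙[w≟u]≡1 u)
    where suc-≟-suc : ∀ w → does (suc w ≟ suc u) ≡ does (w ≟ u)
          suc-≟-suc w with w ≟ u
          ... | yes _ = refl
          ... | no  _ = refl

  ∑-involution : ∀ {n} (π : Fin n → Fin n) → (∀ i → π (π i) ≡ i) →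
                 (f : Fin n → ℕ) → ∑[ i < n ] f (π i) ≡ ∑[ i < n ] f i
  ∑-involution π π∘π f = sym (∑-permute f (Perm.permutation π π π∘π π∘π))

  minimiser : ∀ {n} (P : Fin n → Bool) (f : Fin n → ℕ) →
              (∀ w → P w ≡ false) ⊎ Σ[ u ∈ Fin n ] P u ≡ true × (∀ w → P w ≡ true → f u ≤ f w)
  minimiser {n} P f = search (filter P? (allFin n)) (all-filter P? (allFin n))
                             (λ w Pw → ∈-filter⁺ P? (∈-allFin w) Pw)
    where
    P? = λ w → P w ≟ᴮ true
    search : (xs : List (Fin n)) → All (λ w → P w ≡ true) xs → (∀ w → P w ≡ true → w ∈ xs) →
             (∀ w → P w ≡ false) ⊎ Σ[ u ∈ Fin n ] P u ≡ true × (∀ w → P w ≡ true → f u ≤ f w)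
    search []         _     complete = inj₁ (λ w → ¬-not (¬Any[] ∘ complete w))
    search xs@(x ∷ _) all-P complete = inj₂
      ( argmin f x xs
      , argmin-all f {P = λ w → P w ≡ true} (All.head all-P) all-P
      , λ w Pw → All.lookup (f[argmin]≤f[xs] {f = f} x xs) (complete w Pw) )

  VertexSet : ℕ → Set
  VertexSet v = Fin v → Bool

  module _ {v : ℕ} where

    infix 4 _⊆_
    infixr 6 _∪_ _∩_ _∖_

    _⊆_ : VertexSet v → VertexSet v → Set
    A ⊆ B = ∀ w → A w ≡ true → B w ≡ true

    _∪_ _∩_ _∖_ : VertexSet v → VertexSet v → VertexSet v
    (A ∪ B) w = A w ∨ B w
    (A ∩ B) w = A w ∧ B w
    (A ∖ B) w = A w ∧ not (B w)

    ∅ : VertexSet v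
    ∅ _ = false

    full : VertexSet v
    full _ = true

    ∁ : VertexSet v → VertexSet v
    ∁ A w = not (A w)

    ⁅_⁆ : Fin v → VertexSet v
    ⁅ u ⁆ w = does (w ≟ u)

    ∣_∣ : VertexSet v → ℕ
    ∣ A ∣ = ∑[ w < v ] 𝟙 (A w)

    weight : VertexSet v → (Fin v → ℕ) → ℕ
    weight A g = ∑[ w < v ] (𝟙 (A w) * g w)

    ⊆-false : ∀ {A B} → A ⊆ B → ∀ w → B w ≡ false → A w ≡ false
    ⊆-false {A} A⊆B w Bw≡false with A w in Aw
    ... | false = refl
    ... | true  = trans (sym (A⊆B w Aw)) Bw≡false

    ∣∣-mono : ∀ {A B} → A ⊆ B → ∣ A ∣ ≤ ∣ B ∣
    ∣∣-mono {A} {B} A⊆B = ∑-mono-≤ pointwise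
      where pointwise : ∀ w → 𝟙 (A w) ≤ 𝟙 (B w)
            pointwise w with A w in Aw
            ... | false = z≤n
            ... | true  rewrite A⊆B w Aw = ≤-refl

    ∣∣≡∣∖∣+∣∣ : ∀ {A B} → B ⊆ A → ∣ A ∣ ≡ ∣ A ∖ B ∣ + ∣ B ∣
    ∣∣≡∣∖∣+∣∣ {A} {B} B⊆A = trans (sum-cong-≗ (λ w → 𝟙-split (A w) (B w) (B⊆A w)))
                                  (∑-distrib-+ (𝟙 ∘ (A ∖ B)) (𝟙 ∘ B))

    weight-∖ : ∀ {A B} g → B ⊆ A → weight A g ≡ weight (A ∖ B) g + weight B g
    weight-∖ {A} {B} g B⊆A =
      trans (sum-cong-≗ split) (∑-distrib-+ (λ w → 𝟙 ((A ∖ B) w) * g w) (λ w → 𝟙 (B w) * g w))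
      where split : ∀ w → 𝟙 (A w) * g w ≡ 𝟙 ((A ∖ B) w) * g w + 𝟙 (B w) * g w
            split w = trans (cong (_* g w) (𝟙-split (A w) (B w) (B⊆A w)))
                            (*-distribʳ-+ (g w) (𝟙 ((A ∖ B) w)) (𝟙 (B w)))

    weight-mono : ∀ A {g h} → (∀ w → A w ≡ true → g w ≤ h w) → weight A g ≤ weight A h
    weight-mono A g≤h = ∑-mono-≤ (λ w → 𝟙-*-mono (A w) (g≤h w))

    ∣∣*≤weight : ∀ A {d g} → (∀ w → A w ≡ true → d ≤ g w) → ∣ A ∣ * d ≤ weight A g
    ∣∣*≤weight A {d} d≤g = ≤-trans (≤-reflexive (*-distribʳ-sum d (𝟙 ∘ A))) (weight-mono A d≤g)

    ∣∪∣≤ : ∀ A B → ∣ A ∪ B ∣ ≤ ∣ A ∣ + ∣ B ∣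
    ∣∪∣≤ A B = ≤-trans (∑-mono-≤ (λ w → 𝟙-∨-≤ (A w) (B w)))
                       (≤-reflexive (∑-distrib-+ (𝟙 ∘ A) (𝟙 ∘ B)))

    ∣∪∣-disjoint : ∀ {A B} → (∀ w → A w ≡ true → B w ≡ false) → ∣ A ∪ B ∣ ≡ ∣ A ∣ + ∣ B ∣
    ∣∪∣-disjoint {A} {B} disj = trans (sum-cong-≗ (λ w → 𝟙-∨-disjoint (A w) (B w) (disj w)))
                                      (∑-distrib-+ (𝟙 ∘ A) (𝟙 ∘ B))

    ∣∅∣ : ∀ {A} → (∀ w → A w ≡ false) → ∣ A ∣ ≡ 0
    ∣∅∣ A≡∅ = trans (sum-cong-≗ (cong 𝟙 ∘ A≡∅)) (sum-replicate-zero v)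

    ∣∁∣+∣∣ : ∀ A → ∣ ∁ A ∣ + ∣ A ∣ ≡ v
    ∣∁∣+∣∣ A = trans (sym (∑-distrib-+ (𝟙 ∘ ∁ A) (𝟙 ∘ A)))
                     (trans (sum-cong-≗ (𝟙-not+𝟙 ∘ A)) (∑-const-1 v))
      where 𝟙-not+𝟙 : ∀ b → 𝟙 (not b) + 𝟙 b ≡ 1
            𝟙-not+𝟙 false = refl
            𝟙-not+𝟙 true  = refl

    ∣full∣ : ∣ full ∣ ≡ v
    ∣full∣ = ∑-const-1 v

    ∣⁅⁆∣ : ∀ u → ∣ ⁅ u ⁆ ∣ ≡ 1
    ∣⁅⁆∣ = ∑-𝟙[w≟u]≡1

    ∖-⊆ : ∀ {A B} → A ∖ B ⊆ A
    ∖-⊆ {A} w ABw with A w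
    ... | true = refl

    ∩-⊆ : ∀ {A B} → A ∩ B ⊆ A
    ∩-⊆ {A} w ABw with A w
    ... | true = refl

    ∖-excludes : ∀ {A B} w → (A ∖ B) w ≡ true → B w ≡ false
    ∖-excludes {A} {B} w ABw with A w | B w
    ... | true | false = refl

    ∪-⊆ : ∀ {A B C} → A ⊆ C → B ⊆ C → A ∪ B ⊆ C
    ∪-⊆ {A} A⊆C B⊆C w ABw with A w in Aw
    ... | true  = A⊆C w Aw
    ... | false = B⊆C w ABw

    ⁅⁆⊆ : ∀ {A u} → A u ≡ true → ⁅ u ⁆ ⊆ A
    ⁅⁆⊆ {A} {u} Au w w≟u with w ≟ u
    ... | yes refl = Au

  module _ {v : ℕ} (G : Graph v) where

    deg : VertexSet v → Fin v → ℕ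
    deg R u = ∣ R ∩ adj G u ∣

    degreeSum : VertexSet v → ℕ
    degreeSum R = weight R (deg R)

    deg-mono : ∀ {R S} → R ⊆ S → ∀ u → deg R u ≤ deg S u
    deg-mono {R} {S} R⊆S u = ∣∣-mono R∩N⊆S∩N
      where R∩N⊆S∩N : R ∩ adj G u ⊆ S ∩ adj G u
            R∩N⊆S∩N w Rw∧uw with R w in Rw
            ... | true rewrite R⊆S w Rw = Rw∧uw

    handshake : degreeSum full ≡ 2 * edges G
    handshake = begin
      ∑[ w < v ] (1 * ∑[ j < v ] 𝟙 (adj G w j))
        ≡⟨ sum-cong-≗ (λ w → *-identityˡ (deg full w)) ⟩
      ∑[ w < v ] ∑[ j < v ] 𝟙 (adj G w j)
        ≡⟨ sum-cong-≗ (λ w → trans (sum-cong-≗ (split w)) (∑-distrib-+ (forward w) (backward w))) ⟩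
      ∑[ w < v ] (∑[ j < v ] forward w j + ∑[ j < v ] backward w j)
        ≡⟨ ∑-distrib-+ (λ w → ∑[ j < v ] forward w j) (λ w → ∑[ j < v ] backward w j) ⟩
      ∑[ w < v ] ∑[ j < v ] forward w j + ∑[ w < v ] ∑[ j < v ] backward w j
        ≡⟨ cong (∑[ w < v ] ∑[ j < v ] forward w j +_) (trans (∑-comm backward) backward≡forward) ⟩
      ∑[ w < v ] ∑[ j < v ] forward w j + ∑[ w < v ] ∑[ j < v ] forward w j
        ≡⟨ cong₂ _+_ edges≡ edges≡ ⟨
      edges G + edges G
        ≡⟨ cong (edges G +_) (+-identityʳ (edges G)) ⟨
      2 * edges G ∎
      where
      open ≡-Reasoning
      forward backward : Fin v → Fin v → ℕ
      forward  i j = 𝟙 (adj G i j ∧ (toℕ i <ᵇ toℕ j))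
      backward i j = 𝟙 (adj G i j ∧ (toℕ j <ᵇ toℕ i))
      split : ∀ i j → 𝟙 (adj G i j) ≡ forward i j + backward i j
      split i j = 𝟙-split-<ᵇ (adj G i j) λ i≡j →
        subst (λ j → adj G i j ≡ false) (toℕ-injective i≡j) (loopless G i)
      backward≡forward : ∑[ j < v ] ∑[ w < v ] backward w j ≡ ∑[ j < v ] ∑[ w < v ] forward j w
      backward≡forward = sum-cong-≗ λ j → sum-cong-≗ λ w →
        cong (λ b → 𝟙 (b ∧ (toℕ j <ᵇ toℕ w))) (Graph.sym G w j)
      edges≡ : edges G ≡ ∑[ i < v ] ∑[ j < v ] forward i j
      edges≡ = trans (sumFin≡∑ v _) (sum-cong-≗ (λ i → sumFin≡∑ v (forward i)))

  -- The counting step of the greedy algorithm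

  2*m*n≤m*m+n*n : ∀ m n → 2 * m * n ≤ m * m + n * n
  2*m*n≤m*m+n*n m n = [ ordered m n , flipped ]′ (≤-total m n)
    where
    ordered : ∀ m n → m ≤ n → 2 * m * n ≤ m * m + n * n
    ordered m _ m≤n with k , refl ← m≤n⇒∃[o]m+o≡n m≤n =
      ≤-trans (m≤m+n _ (k * k)) (≤-reflexive (expand m k))
      where expand : ∀ m k → 2 * m * (m + k) + k * k ≡ m * m + (m + k) * (m + k)
            expand = solve-∀
    flipped : n ≤ m → 2 * m * n ≤ m * m + n * n
    flipped n≤m = subst₂ _≤_ (swap n m) (+-comm (n * n) (m * m)) (ordered n m n≤m)
      where swap : ∀ a b → 2 * a * b ≡ 2 * b * a
            swap = solve-∀

  m≤n+n⇒m*m≤2*[m*n] : ∀ {m n} → m ≤ n + n → m * m ≤ 2 * (m * n)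
  m≤n+n⇒m*m≤2*[m*n] {m} {n} m≤n+n = ≤-trans (*-monoʳ-≤ m m≤n+n) (≤-reflexive (double m n))
    where double : ∀ m n → m * (n + n) ≡ 2 * (m * n)
          double = solve-∀

  -- Twice the slack is (2P′ − ρx)² + (ρ² + 2P′) x (2d − x); AM–GM splits off the square.
  greedy-step-core : ∀ ρ x d P′ → x ≤ d + d →
                     P′ * ((ρ + x) * (ρ + x)) ≤ (ρ * ρ + 2 * P′) * (P′ + x * d)
  greedy-step-core ρ x d P′ x≤d+d = *-cancelˡ-≤ 2 (begin
      2 * (P′ * ((ρ + x) * (ρ + x)))
        ≡⟨ expand ρ x P′ ⟩
      2 * (ρ * x) * (2 * P′) + (2 * P′ * (ρ * ρ) + 2 * P′ * (x * x))
        ≤⟨ +-monoˡ-≤ _ (2*m*n≤m*m+n*n (ρ * x) (2 * P′)) ⟩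
      ρ * x * (ρ * x) + 2 * P′ * (2 * P′) + (2 * P′ * (ρ * ρ) + 2 * P′ * (x * x))
        ≡⟨ regroup ρ x P′ ⟩
      (ρ * ρ + 2 * P′) * (2 * P′ + x * x)
        ≤⟨ *-monoʳ-≤ (ρ * ρ + 2 * P′) (+-monoʳ-≤ (2 * P′) (m≤n+n⇒m*m≤2*[m*n] x≤d+d)) ⟩
      (ρ * ρ + 2 * P′) * (2 * P′ + 2 * (x * d))
        ≡⟨ factor ρ x d P′ ⟩
      2 * ((ρ * ρ + 2 * P′) * (P′ + x * d)) ∎)
    where
    open ≤-Reasoning
    expand : ∀ ρ x P′ → 2 * (P′ * ((ρ + x) * (ρ + x))) ≡
             2 * (ρ * x) * (2 * P′) + (2 * P′ * (ρ * ρ) + 2 * P′ * (x * x))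
    expand = solve-∀
    regroup : ∀ ρ x P′ →
              ρ * x * (ρ * x) + 2 * P′ * (2 * P′) + (2 * P′ * (ρ * ρ) + 2 * P′ * (x * x)) ≡
              (ρ * ρ + 2 * P′) * (2 * P′ + x * x)
    regroup = solve-∀
    factor : ∀ ρ x d P′ → (ρ * ρ + 2 * P′) * (2 * P′ + 2 * (x * d)) ≡
                          2 * ((ρ * ρ + 2 * P′) * (P′ + x * d))
    factor = solve-∀

  greedy-step-≤ : ∀ {ρ x d τ P′ P} → x ≤ d + d → P′ + x * d ≤ P → ρ * ρ ≤ τ * P′ →
                  (ρ + x) * (ρ + x) ≤ (τ + 2) * P
  greedy-step-≤ {suc ρ} {τ = τ} {P′ = zero} _ _ ρ²≤τ*0
    with () ← ≤-trans ρ²≤τ*0 (≤-reflexive (*-zeroʳ τ))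
  greedy-step-≤ {zero} {x} {d} {τ} {zero} {P} x≤d+d xd≤P _ = begin
    x * x        ≤⟨ m≤n+n⇒m*m≤2*[m*n] x≤d+d ⟩
    2 * (x * d)  ≤⟨ *-monoʳ-≤ 2 xd≤P ⟩
    2 * P        ≤⟨ *-monoˡ-≤ P (m≤n+m 2 τ) ⟩
    (τ + 2) * P  ∎
    where open ≤-Reasoning
  greedy-step-≤ {ρ} {x} {d} {τ} {P′@(suc _)} {P} x≤d+d P′+xd≤P ρ²≤τP′ = *-cancelˡ-≤ P′ (begin
    P′ * ((ρ + x) * (ρ + x))        ≤⟨ greedy-step-core ρ x d P′ x≤d+d ⟩
    (ρ * ρ + 2 * P′) * (P′ + x * d) ≤⟨ *-monoʳ-≤ (ρ * ρ + 2 * P′) P′+xd≤P ⟩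
    (ρ * ρ + 2 * P′) * P            ≤⟨ *-monoˡ-≤ P (+-monoˡ-≤ (2 * P′) ρ²≤τP′) ⟩
    (τ * P′ + 2 * P′) * P           ≡⟨ factor τ P′ P ⟩
    P′ * ((τ + 2) * P)              ∎)
    where
    open ≤-Reasoning
    factor : ∀ τ P′ P → (τ * P′ + 2 * P′) * P ≡ P′ * ((τ + 2) * P)
    factor = solve-∀

  -- Vertex sets closed under the matching, forcing, and the greedy algorithm

  module _ {v : ℕ} {G : Graph v} (M : PerfectMatching G) where

    private
      m : Fin v → Fin v
      m = partner M

    Closed : VertexSet v → Set
    Closed A = ∀ w → A (m w) ≡ A w

    ∪-closed : ∀ {A B} → Closed A → Closed B → Closed (A ∪ B)
    ∪-closed cA cB w = cong₂ _∨_ (cA w) (cB w)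

    ∖-closed : ∀ {A B} → Closed A → Closed B → Closed (A ∖ B)
    ∖-closed cA cB w = cong₂ (λ a b → a ∧ not b) (cA w) (cB w)

    saturate : VertexSet v → VertexSet v
    saturate A w = A w ∨ A (m w)

    saturate-closed : ∀ A → Closed (saturate A)
    saturate-closed A w = trans (cong (λ z → A (m w) ∨ A z) (invol M w)) (∨-comm (A (m w)) (A w))

    saturate-⊆ : ∀ {A B} → Closed B → A ⊆ B → saturate A ⊆ B
    saturate-⊆ {A} cB A⊆B w Aw∨Amw with A w in Aw | A (m w) in Amw
    ... | true  | _    = A⊆B w Aw
    ... | false | true = trans (sym (cB w)) (A⊆B (m w) Amw)

    ∣∘partner∣ : ∀ A → ∣ A ∘ m ∣ ≡ ∣ A ∣
    ∣∘partner∣ A = ∑-involution m (invol M) (𝟙 ∘ A)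

    ∣saturate∣≤ : ∀ A → ∣ saturate A ∣ ≤ ∣ A ∣ + ∣ A ∣
    ∣saturate∣≤ A = ≤-trans (∣∪∣≤ A (A ∘ m)) (≤-reflexive (cong (∣ A ∣ +_) (∣∘partner∣ A)))

    ∣saturate⁅⁆∣ : ∀ u → ∣ saturate ⁅ u ⁆ ∣ ≡ 2
    ∣saturate⁅⁆∣ u = begin
      ∣ ⁅ u ⁆ ∪ ⁅ u ⁆ ∘ m ∣     ≡⟨ ∣∪∣-disjoint not-both ⟩
      ∣ ⁅ u ⁆ ∣ + ∣ ⁅ u ⁆ ∘ m ∣ ≡⟨ cong (∣ ⁅ u ⁆ ∣ +_) (∣∘partner∣ ⁅ u ⁆) ⟩
      ∣ ⁅ u ⁆ ∣ + ∣ ⁅ u ⁆ ∣     ≡⟨ cong₂ _+_ (∣⁅⁆∣ u) (∣⁅⁆∣ u) ⟩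
      2                        ∎
      where
      open ≡-Reasoning
      not-both : ∀ w → ⁅ u ⁆ w ≡ true → ⁅ u ⁆ (m w) ≡ false
      not-both w w≟u with w ≟ u
      ... | yes refl = dec-false (m w ≟ w) (noFix M w)

    toEdgeSubset : (A : VertexSet v) → Closed A → EdgeSubset M
    toEdgeSubset A cA = record { mem = A ; closed = λ i → sym (cA i) }

    ∣∣≡2*size : ∀ {A} (cA : Closed A) → ∣ A ∣ ≡ 2 * size (toEdgeSubset A cA)
    ∣∣≡2*size {A} cA = begin
      ∣ A ∣
        ≡⟨ sum-cong-≗ split ⟩
      ∑[ i < v ] (lower i + lower (m i))
        ≡⟨ ∑-distrib-+ lower (lower ∘ m) ⟩
      ∑[ i < v ] lower i + ∑[ i < v ] lower (m i)
        ≡⟨ cong (∑[ i < v ] lower i +_) (∑-involution m (invol M) lower) ⟩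
      ∑[ i < v ] lower i + ∑[ i < v ] lower i
        ≡⟨ cong₂ _+_ (sumFin≡∑ v lower) (sumFin≡∑ v lower) ⟨
      size S + size S
        ≡⟨ cong (size S +_) (+-identityʳ (size S)) ⟨
      2 * size S ∎
      where
      open ≡-Reasoning
      S = toEdgeSubset A cA
      lower : Fin v → ℕ
      lower i = 𝟙 (A i ∧ (toℕ i <ᵇ toℕ (m i)))
      split : ∀ i → 𝟙 (A i) ≡ lower i + lower (m i)
      split i rewrite cA i | invol M i =
        𝟙-split-<ᵇ (A i) (λ i≡mi → contradiction (toℕ-injective (sym i≡mi)) (noFix M i))

    ∁-closed : ∀ {A} → Closed A → Closed (∁ A)
    ∁-closed cA w = cong not (cA w)

    ForcedOutside : VertexSet v → Set
    ForcedOutside T = ∀ (M′ : PerfectMatching G) →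
      (∀ w → T w ≡ false → partner M′ w ≡ m w) → ∀ w → partner M′ w ≡ m w

    forcing-∁ : ∀ {T} (cT : Closed T) → ForcedOutside T → Forcing M (toEdgeSubset (∁ T) (∁-closed cT))
    forcing-∁ {T} _ forced M′ contained = forced M′ (λ w Tw≡false → contained w (cong not Tw≡false))

    record GreedyForcing (R : VertexSet v) : Set where
      field
        free        : VertexSet v
        free⊆R      : free ⊆ R
        free-closed : Closed free
        forced      : ForcedOutside free
        bound       : ∣ R ∣ * ∣ R ∣ ≤ ∣ free ∣ * degreeSum G R

    greedy-∅ : ∀ {R} → (∀ w → R w ≡ false) → GreedyForcing R
    greedy-∅ {R} R≡∅ = record
      { free        = ∅
      ; free⊆R      = λ _ ()
      ; free-closed = λ _ → refl
      ; forced      = λ M′ agree w → agree w refl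
      ; bound       = ≤-trans (≤-reflexive (cong (λ k → k * k) (∣∅∣ R≡∅))) z≤n
      }

    module GreedyStep {R : VertexSet v} (R-closed : Closed R) {u : Fin v} (u∈R : R u ≡ true)
                      (u-min : ∀ w → R w ≡ true → deg G R u ≤ deg G R w) where

      d : ℕ
      d = deg G R u

      X : VertexSet v
      X = saturate (R ∩ adj G u)

      R′ : VertexSet v
      R′ = R ∖ X

      X⊆R : X ⊆ R
      X⊆R = saturate-⊆ R-closed ∩-⊆

      X-closed : Closed X
      X-closed = saturate-closed (R ∩ adj G u)

      R′-closed : Closed R′
      R′-closed = ∖-closed R-closed X-closed

      u∈X : X u ≡ true
      u∈X = trans (cong ((R ∩ adj G u) u ∨_) (cong₂ _∧_ (trans (R-closed u) u∈R) (isEdge M u)))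
                  (∨-zeroʳ _)

      ∣R∣≡∣R′∣+∣X∣ : ∣ R ∣ ≡ ∣ R′ ∣ + ∣ X ∣
      ∣R∣≡∣R′∣+∣X∣ = ∣∣≡∣∖∣+∣∣ X⊆R

      ∣R′∣<∣R∣ : ∣ R′ ∣ < ∣ R ∣
      ∣R′∣<∣R∣ = begin-strict
        ∣ R′ ∣          <⟨ m<m+n ∣ R′ ∣ (subst (_≤ ∣ X ∣) (∣⁅⁆∣ u) (∣∣-mono (⁅⁆⊆ {A = X} u∈X))) ⟩
        ∣ R′ ∣ + ∣ X ∣  ≡⟨ ∣R∣≡∣R′∣+∣X∣ ⟨
        ∣ R ∣           ∎
        where open ≤-Reasoning

      ∣X∣≤d+d : ∣ X ∣ ≤ d + d
      ∣X∣≤d+d = ∣saturate∣≤ (R ∩ adj G u)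

      degreeSum-peel : degreeSum G R′ + ∣ X ∣ * d ≤ degreeSum G R
      degreeSum-peel = begin
        weight R′ (deg G R′) + ∣ X ∣ * d
          ≤⟨ +-mono-≤ (weight-mono R′ (λ w _ → deg-mono G (∖-⊆ {A = R} {B = X}) w))
                      (∣∣*≤weight X (λ w Xw → u-min w (X⊆R w Xw))) ⟩
        weight R′ (deg G R) + weight X (deg G R)
          ≡⟨ weight-∖ (deg G R) X⊆R ⟨
        weight R (deg G R) ∎
        where open ≤-Reasoning

      neighbour∉R′ : ∀ {z} → adj G u z ≡ true → R′ z ≡ false
      neighbour∉R′ {z} uz rewrite uz with R z
      ... | false = refl
      ... | true  = refl

      extend : GreedyForcing R′ → GreedyForcing R
      extend peeled = record
        { free        = T
        ; free⊆R      = ∪-⊆ (λ w → ∖-⊆ {A = R} {B = X} w ∘ T′⊆R′ w) (λ w → X⊆R w ∘ E⊆X w)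
        ; free-closed = ∪-closed T′-closed (saturate-closed ⁅ u ⁆)
        ; forced      = forcedT
        ; bound       = subst₂ (λ r t → r * r ≤ t * degreeSum G R) (sym ∣R∣≡∣R′∣+∣X∣) (sym ∣T∣≡∣T′∣+2)
                          (greedy-step-≤ {ρ = ∣ R′ ∣} {τ = ∣ T′ ∣} ∣X∣≤d+d degreeSum-peel bound′)
        }
        where
        open GreedyForcing peeled renaming (free to T′; free⊆R to T′⊆R′; free-closed to T′-closed;
                                            forced to forced′; bound to bound′)
        E : VertexSet v
        E = saturate ⁅ u ⁆

        T : VertexSet v
        T = T′ ∪ E

        E⊆X : E ⊆ X
        E⊆X = saturate-⊆ X-closed (⁅⁆⊆ {A = X} u∈X)

        ∣T∣≡∣T′∣+2 : ∣ T ∣ ≡ ∣ T′ ∣ + 2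
        ∣T∣≡∣T′∣+2 = trans (∣∪∣-disjoint T′∩E≡∅) (cong (∣ T′ ∣ +_) (∣saturate⁅⁆∣ u))
          where T′∩E≡∅ : ∀ w → T′ w ≡ true → E w ≡ false
                T′∩E≡∅ w T′w = ⊆-false E⊆X w (∖-excludes {A = R} {B = X} w (T′⊆R′ w T′w))

        E-false : ∀ {w} → w ≢ u → m w ≢ u → E w ≡ false
        E-false {w} w≢u mw≢u = cong₂ _∨_ (dec-false (w ≟ u) w≢u) (dec-false (m w ≟ u) mw≢u)

        forcedT : ForcedOutside T
        forcedT M′ agree = forced′ M′ agree′
          where
          m′ = partner M′
          z = m′ u
          -- z is a neighbour of u, hence not in T′; if m z ≢ u it is not in T either,
          -- and then M′ agrees with M at z, so m z = m′ (m′ u) = u after all.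
          z∉T′ : T′ z ≡ false
          z∉T′ = ⊆-false T′⊆R′ z (neighbour∉R′ (isEdge M′ u))
          m′u≡mu : m′ u ≡ m u
          m′u≡mu with m z ≟ u
          ... | yes mz≡u = trans (sym (invol M z)) (cong m mz≡u)
          ... | no  mz≢u = contradiction (trans (sym (agree z z∉T)) (invol M′ u)) mz≢u
            where z∉T : T z ≡ false
                  z∉T = cong₂ _∨_ z∉T′ (E-false (noFix M′ u) mz≢u)
          agree′ : ∀ w → T′ w ≡ false → m′ w ≡ m w
          agree′ w w∉T′ with w ≟ u | m w ≟ u
          ... | yes refl | _        = m′u≡mu
          ... | no  _    | yes mw≡u =
            trans (cong m′ (trans w≡mu (sym m′u≡mu))) (trans (invol M′ u) (sym mw≡u))
            where w≡mu : w ≡ m u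
                  w≡mu = trans (sym (invol M w)) (cong m mw≡u)
          ... | no  w≢u  | no mw≢u  = agree w (cong₂ _∨_ w∉T′ (E-false w≢u mw≢u))

    greedy : ∀ R → Closed R → GreedyForcing R
    greedy = WF.All.wfRec (On.wellFounded (∣_∣ {v}) <-wellFounded) _
                          (λ R → Closed R → GreedyForcing R) step
      where
      step : ∀ R → (∀ {R′} → ∣ R′ ∣ < ∣ R ∣ → Closed R′ → GreedyForcing R′) → Closed R → GreedyForcing R
      step R smaller R-closed with minimiser R (deg G R)
      ... | inj₁ R≡∅                = greedy-∅ R≡∅
      ... | inj₂ (u , u∈R , u-min) = extend (smaller ∣R′∣<∣R∣ R′-closed)
        where open GreedyStep R-closed u∈R u-min

    unforced-set : Σ[ T ∈ VertexSet v ] Closed T × ForcedOutside T × v * v ≤ ∣ T ∣ * (2 * edges G)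
    unforced-set = free , free-closed , forced ,
      subst₂ (λ a b → a * a ≤ ∣ free ∣ * b) (∣full∣ {v}) (handshake G) bound
      where open GreedyForcing (greedy full (λ _ → refl))

  greedy-forcing-set : ∀ n {G : Graph (2 * n)} (M : PerfectMatching G) →
    Σ[ S ∈ EdgeSubset M ] Forcing M S × Σ[ t ∈ ℕ ] size S + t ≡ n × n * n ≤ t * edges G
  greedy-forcing-set n {G} M with T , T-closed , forced , [2n]²≤∣T∣*2e ← unforced-set M =
    S , forcing-∁ M T-closed forced , t , s+t≡n , n²≤te
    where
    S = toEdgeSubset M (∁ T) (∁-closed M T-closed)
    t = size (toEdgeSubset M T T-closed)
    s+t≡n : size S + t ≡ n
    s+t≡n = *-cancelˡ-≡ _ _ 2 (begin
      2 * (size S + t)   ≡⟨ *-distribˡ-+ 2 (size S) t ⟩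
      2 * size S + 2 * t ≡⟨ cong₂ _+_ (∣∣≡2*size M (∁-closed M T-closed)) (∣∣≡2*size M T-closed) ⟨
      ∣ ∁ T ∣ + ∣ T ∣    ≡⟨ ∣∁∣+∣∣ T ⟩
      2 * n              ∎)
      where open ≡-Reasoning
    n²≤te : n * n ≤ t * edges G
    n²≤te = *-cancelˡ-≤ 4 (begin
      4 * (n * n)             ≡⟨ double-* n n ⟨
      (2 * n) * (2 * n)       ≤⟨ [2n]²≤∣T∣*2e ⟩
      ∣ T ∣ * (2 * edges G)   ≡⟨ cong (_* (2 * edges G)) (∣∣≡2*size M T-closed) ⟩
      (2 * t) * (2 * edges G) ≡⟨ double-* t (edges G) ⟩
      4 * (t * edges G)       ∎)
      where
      open ≤-Reasoning
      double-* : ∀ a b → (2 * a) * (2 * b) ≡ 4 * (a * b)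
      double-* = solve-∀

  -- Squaring out the bound

  -- The paper's F ≤ (√(e² + 2(n+1)e − 3n² − 2n + 1) − (e + 1 − n)) / 2, cleared of the root.
  SquaredBound : ℕ → ℕ → ℕ → Set
  SquaredBound n e F =
    let lhs = (ℤ.+ (2 * F + e + 1)) ℤ.- ℤ.+ n
    in lhs ℤ.* lhs ℤ.≤ (ℤ.+ (e * e + 2 * (n + 1) * e + 1)) ℤ.- ℤ.+ (3 * n * n + 2 * n)

  [+[m+n]]-[+m]≡+n : ∀ m n → ℤ.+ (m + n) ℤ.- ℤ.+ m ≡ ℤ.+ n
  [+[m+n]]-[+m]≡+n m n = begin
    ℤ.+ (m + n) ℤ.- ℤ.+ m  ≡⟨ ℤ.[+m]-[+n]≡m⊖n (m + n) m ⟩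
    (m + n) ℤ.⊖ m          ≡⟨ ℤ.⊖-≥ (m≤m+n m n) ⟩
    ℤ.+ (m + n ∸ m)        ≡⟨ cong ℤ.+_ (m+n∸m≡n m n) ⟩
    ℤ.+ n                  ∎
    where open ≡-Reasoning

  F*[F+1]+F*E≤n*E : ∀ {F s t E} → F ≤ s → (s + t) * (s + t) ≤ t * (s + t + E) →
                    F * (F + 1) + F * E ≤ (s + t) * E
  F*[F+1]+F*E≤n*E {s = zero}  {zero} z≤n _ = z≤n
  F*[F+1]+F*E≤n*E {s = suc s} {zero} _ ()
  F*[F+1]+F*E≤n*E {F} {s} {t@(suc _)} {E} F≤s n²≤t[n+E] = begin
    F * (F + 1) + F * E ≤⟨ +-mono-≤ (*-mono-≤ F≤s F+1≤n) (*-monoˡ-≤ E F≤s) ⟩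
    s * n + s * E       ≤⟨ +-monoˡ-≤ (s * E) sn≤tE ⟩
    t * E + s * E       ≡⟨ *-distribʳ-+ E t s ⟨
    (t + s) * E         ≡⟨ cong (_* E) (+-comm t s) ⟩
    n * E               ∎
    where
    open ≤-Reasoning
    n = s + t
    F+1≤n : F + 1 ≤ n
    F+1≤n = +-mono-≤ F≤s (s≤s z≤n)
    sn≤tE : s * n ≤ t * E
    sn≤tE = +-cancelˡ-≤ (t * n) _ _ (begin
      t * n + s * n ≡⟨ *-distribʳ-+ n t s ⟨
      (t + s) * n   ≡⟨ cong (_* n) (+-comm t s) ⟩
      n * n         ≤⟨ n²≤t[n+E] ⟩
      t * (n + E)   ≡⟨ *-distribˡ-+ t n E ⟩
      t * n + t * E ∎)

  squaredBound-ℕ : ∀ F n E → F * (F + 1) + F * E ≤ n * E →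
                   (2 * F + E + 1) * (2 * F + E + 1) ≤ 4 * n * E + E * E + 2 * E + 1
  squaredBound-ℕ F n E h = begin
    (2 * F + E + 1) * (2 * F + E + 1)               ≡⟨ expand F E ⟩
    4 * (F * (F + 1) + F * E) + (E * E + 2 * E + 1) ≤⟨ +-monoˡ-≤ _ (*-monoʳ-≤ 4 h) ⟩
    4 * (n * E) + (E * E + 2 * E + 1)               ≡⟨ regroup n E ⟩
    4 * n * E + E * E + 2 * E + 1                   ∎
    where
    open ≤-Reasoning
    expand : ∀ F E → (2 * F + E + 1) * (2 * F + E + 1) ≡
                     4 * (F * (F + 1) + F * E) + (E * E + 2 * E + 1)
    expand = solve-∀
    regroup : ∀ n E → 4 * (n * E) + (E * E + 2 * E + 1) ≡ 4 * n * E + E * E + 2 * E + 1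
    regroup = solve-∀

  squaredBound-n+E : ∀ F n E → F * (F + 1) + F * E ≤ n * E → SquaredBound n (n + E) F
  squaredBound-n+E F n E h = begin
    lhs ℤ.* lhs                           ≡⟨ cong (λ z → z ℤ.* z) lhs≡+L ⟩
    ℤ.+ L ℤ.* ℤ.+ L                       ≡⟨ ℤ.pos-* L L ⟨
    ℤ.+ (L * L)                           ≤⟨ ℤ.+≤+ (squaredBound-ℕ F n E h) ⟩
    ℤ.+ (4 * n * E + E * E + 2 * E + 1)   ≡⟨ rhs≡+R ⟨
    ℤ.+ (e * e + 2 * (n + 1) * e + 1) ℤ.- ℤ.+ (3 * n * n + 2 * n) ∎
    where
    open ℤ.≤-Reasoning
    e = n + E
    L = 2 * F + E + 1
    lhs = ℤ.+ (2 * F + e + 1) ℤ.- ℤ.+ n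
    lhs≡+L : lhs ≡ ℤ.+ L
    lhs≡+L = trans (cong (λ z → ℤ.+ z ℤ.- ℤ.+ n) (shift F n E)) ([+[m+n]]-[+m]≡+n n L)
      where shift : ∀ F n E → 2 * F + (n + E) + 1 ≡ n + (2 * F + E + 1)
            shift = solve-∀
    rhs≡+R : ℤ.+ (e * e + 2 * (n + 1) * e + 1) ℤ.- ℤ.+ (3 * n * n + 2 * n) ≡
             ℤ.+ (4 * n * E + E * E + 2 * E + 1)
    rhs≡+R = trans (cong (λ z → ℤ.+ z ℤ.- ℤ.+ (3 * n * n + 2 * n)) (expand n E))
                   ([+[m+n]]-[+m]≡+n (3 * n * n + 2 * n) (4 * n * E + E * E + 2 * E + 1))
      where expand : ∀ n E → (n + E) * (n + E) + 2 * (n + 1) * (n + E) + 1 ≡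
                             3 * n * n + 2 * n + (4 * n * E + E * E + 2 * E + 1)
            expand = solve-∀

  n*n≤t*e⇒n≤e : ∀ {n t e} → t ≤ n → n * n ≤ t * e → n ≤ e
  n*n≤t*e⇒n≤e {zero}      _   _     = z≤n
  n*n≤t*e⇒n≤e {n@(suc _)} t≤n n²≤te = *-cancelˡ-≤ n (≤-trans n²≤te (*-monoˡ-≤ _ t≤n))

  quadratic-bound : ∀ {F s t n e} → F ≤ s → s + t ≡ n → n * n ≤ t * e → SquaredBound n e F
  quadratic-bound {F} {s} {t} F≤s refl n²≤te
    with E , refl ← m≤n⇒∃[o]m+o≡n (n*n≤t*e⇒n≤e (m≤n+m t s) n²≤te) =
    squaredBound-n+E F (s + t) E (F*[F+1]+F*E≤n*E F≤s n²≤te)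

open ForcingBound using (greedy-forcing-set; quadratic-bound)
open import Data.Integer using (ℤ; +_; _+_; _-_; _*_; _≤_)
open import Data.Product.Base using (_,_)

corollary3p5 : (n : ℕ) (G : Graph (2 Data.Nat.* n)) → PerfectMatching G →
    (F : ℕ) → IsMaxForcingNumber G F →
    let e = edges G
        lhs = (+ (2 Data.Nat.* F Data.Nat.+ e Data.Nat.+ 1)) - + n
    in lhs * lhs ≤ (+ (e Data.Nat.* e Data.Nat.+ 2 Data.Nat.* (n Data.Nat.+ 1) Data.Nat.* e Data.Nat.+ 1))
                   - + (3 Data.Nat.* n Data.Nat.* n Data.Nat.+ 2 Data.Nat.* n)
corollary3p5 n G _ F ((M , (_ , F-minimal)) , _)
  with S , S-forcing , t , s+t≡n , n²≤te ← greedy-forcing-set n M =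
  quadratic-bound (F-minimal S S-forcing) s+t≡n n²≤te
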